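{- Let $G$ be the graph on vertex set $V=\{1,2,3,v\}$ whose edges are exactly $\{1,2\},\{1,3\},\{2,3\}$ (the disjoint union of a triangle $K_3$ and an isolated vertex $v$). Then $\mathcal{R}_\pi(G)=3$, and there is no square-free word that is a concatenation of three permutations of $V$ and is a $1$-$11$-representation of $G$.
   Context: For a word $w$ and letters $x,y$, $w_{\{x,y\}}$ denotes the word obtained from $w$ by deleting all letters other than $x$ and $y$. A word $w\in V^{+}$ is a $1$-$11$-representation of a graph $G(V,E)$ if for all distinct $x,y\in V$: $x,y$ are adjacent in $G$ iff $w_{\{x,y\}}$ contains at most one factor of the form $xx$ or $yy$ in total (equivalently, non-adjacent iff $w_{\{x,y\}}$ contains at least two occurrences of $xx$, or at least two of $yy$, or at least one of each). A $1$-$11$-representation is permutational if it is a concatenation of permutations of $V$ (words in which each vertex occurs exactly once). $\mathcal{R}_\pi(G)$ is the minimum number of permutations in a permutational $1$-$11$-representation of $G$. A word is square-free if it cannot be written as $s_1XXs_2$ with $s_1,s_2$ possibly empty and $X$ nonempty. -}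

module Defs where

open import Data.Nat using (ℕ; zero; suc; _+_; _≤_; _<_)
open import Data.Fin using (Fin; zero; suc)
open import Data.Fin.Properties using (_≟_)
open import Data.List using (List; []; _∷_; _++_; concat; length; filter)
open import Data.List.Relation.Unary.All using (All)
open import Data.Product using (Σ; ∃; _×_; _,_)
open import Data.Sum using (_⊎_)
open import Data.Empty using (⊥)
open import Relation.Nullary using (¬_; yes; no; _⊎-dec_)
open import Relation.Binary.PropositionalEquality using (_≡_; _≢_)
open import Function.Bundles using (_⇔_)

restrict : ∀ {n} → Fin n → Fin n → List (Fin n) → List (Fin n)
restrict x y = filter (λ z → (z ≟ x) ⊎-dec (z ≟ y))

-- number of (possibly overlapping) occurrences of the factor aa in a word
-- squaresFrom a b u counts occurrences of aa in the word b u
squaresFrom : ∀ {n} → Fin n → Fin n → List (Fin n) → ℕ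
squaresFrom a b [] = 0
squaresFrom a b (c ∷ u) with b ≟ a | c ≟ a
... | yes _ | yes _ = suc (squaresFrom a c u)
... | _     | _     = squaresFrom a c u

squares : ∀ {n} → Fin n → List (Fin n) → ℕ
squares a [] = 0
squares a (b ∷ u) = squaresFrom a b u

Is1-11-Rep : ∀ {n} → (Fin n → Fin n → Set) → List (Fin n) → Set
Is1-11-Rep {n} E w =
  (w ≢ []) ×
  ((x y : Fin n) → x ≢ y →
     (E x y ⇔ (squares x (restrict x y w) + squares y (restrict x y w) ≤ 1)))

IsPermutation : ∀ {n} → List (Fin n) → Set
IsPermutation {n} p = (x : Fin n) → length (filter (_≟ x) p) ≡ 1

IsConcatOfPerms : ∀ {n} → ℕ → List (Fin n) → Set
IsConcatOfPerms {n} k w =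
  Σ (List (List (Fin n))) λ ps → length ps ≡ k × All IsPermutation ps × w ≡ concat ps

HasPermRep : ∀ {n} → (Fin n → Fin n → Set) → ℕ → Set
HasPermRep E k = Σ _ λ w → IsConcatOfPerms k w × Is1-11-Rep E w

Rπ≡ : ∀ {n} → (Fin n → Fin n → Set) → ℕ → Set
Rπ≡ E k = HasPermRep E k × ((j : ℕ) → j < k → ¬ HasPermRep E j)

SquareFree : ∀ {A : Set} → List A → Set
SquareFree {A} w =
  ¬ (Σ (List A) λ s₁ → Σ (List A) λ X → Σ (List A) λ s₂ →
       (X ≢ []) × (w ≡ s₁ ++ X ++ X ++ s₂))

-- The graph K₃ + K₁ on V = {1,2,3,v}, encoded as Fin 4 with
-- 1 ↦ 0, 2 ↦ 1, 3 ↦ 2, v ↦ 3.  Edges: exactly {1,2},{1,3},{2,3}.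
data K3+K1-Adj : Fin 4 → Fin 4 → Set where
  e01 : K3+K1-Adj zero (suc zero)
  e10 : K3+K1-Adj (suc zero) zero
  e02 : K3+K1-Adj zero (suc (suc zero))
  e20 : K3+K1-Adj (suc (suc zero)) zero
  e12 : K3+K1-Adj (suc zero) (suc (suc zero))
  e21 : K3+K1-Adj (suc (suc zero)) (suc zero)

module Submission where

-- For distinct x and y, the restriction of a concatenation of permutations p₁ ⋯ pₖ to {x, y}
-- is a sequence of k blocks xy or yx, and its factors xx and yy sit exactly where the order of
-- x and y changes from one block to the next.  So for k ≤ 2 every pair is adjacent, and for
-- k = 3 a pair is non-adjacent iff its order zigzags: equal in p₁ and p₃, reversed in p₂.
-- Zigzags compose, so if the isolated vertex v had triangle vertices on both of its sides in p₁,
-- those two would zigzag as well.  Hence v is first or last in p₁, and then v ends one of the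
-- permutations and starts the next, which is the factor vv.  The word 0123·3012·0123 shows
-- that three permutations suffice.

open import Defs
open import Data.Bool using (Bool; true; false; not)
open import Data.Empty using (⊥-elim)
open import Data.Fin using (Fin)
open import Data.Fin.Patterns using (0F; 1F; 2F; 3F)
open import Data.Fin.Properties using (_≟_)
open import Data.List
  using (List; []; _∷_; _++_; _∷ʳ_; concat; concatMap; length; filter; map; initLast; _∷ʳ′_)
open import Data.List.Membership.Propositional using (_∈_)
open import Data.List.Properties
  using (filter-accept; filter-++; filter-≐; map-++; ∷ʳ-injectiveʳ; ∷ʳ-++; ++-assoc)
open import Data.List.Relation.Binary.Pointwise using (Pointwise; []; _∷_; Pointwise-length)
open import Data.List.Relation.Unary.All using (All; []; _∷_)
open import Data.List.Relation.Unary.Any using (here; there)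
open import Data.Nat using (ℕ; suc; _+_; _≤_; _<_; z≤n; s≤s)
open import Data.Nat.Properties using (suc-injective; ≤-reflexive; ≤-pred; ≰⇒>; ≤⇒≯; _≤?_)
open import Data.Product using (∃; ∃₂; _×_; _,_; proj₂)
open import Data.Sum using (_⊎_; inj₁; inj₂; swap)
open import Function.Base using (_∘_)
open import Function.Bundles using (_⇔_; mk⇔; Equivalence)
open import Function.Definitions using (Injective)
open import Relation.Binary.PropositionalEquality
  using (_≡_; _≢_; refl; sym; trans; cong; cong₂; subst; _≗_; module ≡-Reasoning)
open import Relation.Nullary using (¬_; yes; no; _⊎-dec_)
open import Relation.Nullary.Decidable using (True; False; toWitness; toWitnessFalse)

data Precedes {A : Set} (x y : A) : List A → Set where
  here  : ∀ {p} → Precedes x y (x ∷ p)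
  there : ∀ {c p} → c ≢ x → c ≢ y → Precedes x y p → Precedes x y (c ∷ p)

module _ {A : Set} {x y z : A} where

  precedes-trans : ∀ {p} → Precedes x y p → Precedes y z p → Precedes x z p
  precedes-trans here              _                 = here
  precedes-trans (there _ c≢y _)   here              = ⊥-elim (c≢y refl)
  precedes-trans (there c≢x _ x<y) (there _ c≢z y<z) = there c≢x c≢z (precedes-trans x<y y<z)

precedes-antisym : ∀ {A : Set} {x y : A} {p} → Precedes x y p → Precedes y x p → x ≡ y
precedes-antisym here            here            = refl
precedes-antisym here            (there _ c≢x _) = ⊥-elim (c≢x refl)
precedes-antisym (there _ c≢y _) here            = ⊥-elim (c≢y refl)
precedes-antisym (there _ _ x<y) (there _ _ y<x) = precedes-antisym x<y y<x

precedes-head : ∀ {A : Set} {x y : A} {p} → Precedes x y (y ∷ p) → x ≡ y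
precedes-head here            = refl
precedes-head (there _ c≢y _) = ⊥-elim (c≢y refl)

module _ {n : ℕ} where

  count : Fin n → List (Fin n) → ℕ
  count x p = length (filter (_≟ x) p)

  count≡1⇒∈ : ∀ {x : Fin n} {p} → count x p ≡ 1 → x ∈ p
  count≡1⇒∈ {x} {c ∷ p} once with c ≟ x
  ... | yes refl = here refl
  ... | no _     = there (count≡1⇒∈ once)

  precedes-total : ∀ {x y : Fin n} {p} → x ∈ p → Precedes x y p ⊎ Precedes y x p
  precedes-total {x} {y} {c ∷ p} x∈p with c ≟ x | c ≟ y
  ... | yes refl | _        = inj₁ here
  ... | no _     | yes refl = inj₂ here
  ... | no c≢x   | no c≢y   with x∈p
  ...   | here x≡c   = ⊥-elim (c≢x (sym x≡c))
  ...   | there x∈p′ with precedes-total {y = y} x∈p′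
  ...     | inj₁ x<y = inj₁ (there c≢x c≢y x<y)
  ...     | inj₂ y<x = inj₂ (there c≢y c≢x y<x)

  restrict-comm : (x y : Fin n) → restrict x y ≗ restrict y x
  restrict-comm x y =
    filter-≐ (λ z → (z ≟ x) ⊎-dec (z ≟ y)) (λ z → (z ≟ y) ⊎-dec (z ≟ x)) (swap , swap)

  restrict-∷ʳ : (x y : Fin n) (s : List (Fin n)) → restrict x y (s ∷ʳ x) ≡ restrict x y s ∷ʳ x
  restrict-∷ʳ x y s =
    trans (filter-++ _ s (x ∷ []))
          (cong (restrict x y s ++_) (filter-accept (λ z → (z ≟ x) ⊎-dec (z ≟ y)) (inj₁ refl)))

  restrict-absent : ∀ {x y : Fin n} {p} → count x p ≡ 0 → count y p ≡ 0 → restrict x y p ≡ []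
  restrict-absent {x} {y} {[]}    _  _  = refl
  restrict-absent {x} {y} {c ∷ p} cx cy with c ≟ x | c ≟ y
  ... | yes refl | _        with () ← cx
  ... | no _     | yes refl with () ← cy
  ... | no _     | no _     = restrict-absent {x} {y} {p} cx cy

  restrict-single : ∀ {x y : Fin n} {p} → count x p ≡ 0 → count y p ≡ 1 → restrict x y p ≡ y ∷ []
  restrict-single {x} {y} {c ∷ p} cx cy with c ≟ x | c ≟ y
  ... | yes refl | _        with () ← cx
  ... | no _     | yes refl = cong (y ∷_) (restrict-absent {x} {y} {p} cx (suc-injective cy))
  ... | no _     | no _     = restrict-single {x} {y} {p} cx cy

  restrict-precedes : ∀ {x y : Fin n} {p} → x ≢ y → count x p ≡ 1 → count y p ≡ 1 →
                      Precedes x y p → restrict x y p ≡ x ∷ y ∷ []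
  restrict-precedes {x} {y} {x ∷ p} x≢y cx cy here with x ≟ x | x ≟ y
  ... | no x≢x | _       = ⊥-elim (x≢x refl)
  ... | yes _  | yes x≡y = ⊥-elim (x≢y x≡y)
  ... | yes _  | no _    = cong (x ∷_) (restrict-single {x} {y} {p} (suc-injective cx) cy)
  restrict-precedes {x} {y} {c ∷ p} x≢y cx cy (there c≢x c≢y x<y) with c ≟ x | c ≟ y
  ... | yes c≡x | _       = ⊥-elim (c≢x c≡x)
  ... | no _    | yes c≡y = ⊥-elim (c≢y c≡y)
  ... | no _    | no _    = restrict-precedes {x} {y} {p} x≢y cx cy x<y

module _ {m n : ℕ} {f : Fin m → Fin n} (f-injective : Injective _≡_ _≡_ f) where

  squaresFrom-map : ∀ a b u → squaresFrom (f a) (f b) (map f u) ≡ squaresFrom a b u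
  squaresFrom-map a b []      = refl
  squaresFrom-map a b (c ∷ u) with b ≟ a | c ≟ a | f b ≟ f a | f c ≟ f a
  ... | yes _   | yes _   | yes _     | yes _     = cong suc (squaresFrom-map a c u)
  ... | yes b≡a | _       | no fb≢fa  | _         = ⊥-elim (fb≢fa (cong f b≡a))
  ... | _       | yes c≡a | _         | no fc≢fa  = ⊥-elim (fc≢fa (cong f c≡a))
  ... | no b≢a  | _       | yes fb≡fa | _         = ⊥-elim (b≢a (f-injective fb≡fa))
  ... | _       | no c≢a  | _         | yes fc≡fa = ⊥-elim (c≢a (f-injective fc≡fa))
  ... | no _    | no _    | no _      | no _      = squaresFrom-map a c u
  ... | yes _   | no _    | yes _     | no _      = squaresFrom-map a c u
  ... | no _    | yes _   | no _      | yes _     = squaresFrom-map a c u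

  squares-map : ∀ a u → squares (f a) (map f u) ≡ squares a u
  squares-map a []      = refl
  squares-map a (b ∷ u) = squaresFrom-map a b u

squareCount : ∀ {n} → Fin n → Fin n → List (Fin n) → ℕ
squareCount x y w = squares x (restrict x y w) + squares y (restrict x y w)

twoLetterSquares : List (Fin 2) → ℕ
twoLetterSquares u = squares 0F u + squares 1F u

pairing : ∀ {n} → Fin n → Fin n → Fin 2 → Fin n
pairing x y 0F = x
pairing x y 1F = y

module _ {n : ℕ} {x y : Fin n} (x≢y : x ≢ y) where

  pairing-injective : Injective _≡_ _≡_ (pairing x y)
  pairing-injective {0F} {0F} _   = refl
  pairing-injective {0F} {1F} x≡y = ⊥-elim (x≢y x≡y)
  pairing-injective {1F} {0F} y≡x = ⊥-elim (x≢y (sym y≡x))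
  pairing-injective {1F} {1F} _   = refl

  squareCount-pairing : ∀ {w} u → restrict x y w ≡ map (pairing x y) u →
                        squareCount x y w ≡ twoLetterSquares u
  squareCount-pairing u eq rewrite eq =
    cong₂ _+_ (squares-map pairing-injective 0F u) (squares-map pairing-injective 1F u)

block : Bool → List (Fin 2)
block true  = 0F ∷ 1F ∷ []
block false = 1F ∷ 0F ∷ []

blockSquares : List Bool → ℕ
blockSquares bs = twoLetterSquares (concatMap block bs)

blockSquares-≤1 : ∀ bs → length bs ≤ 2 → blockSquares bs ≤ 1
blockSquares-≤1 []                   _ = z≤n
blockSquares-≤1 (true  ∷ [])         _ = z≤n
blockSquares-≤1 (false ∷ [])         _ = z≤n
blockSquares-≤1 (true  ∷ true  ∷ []) _ = z≤n
blockSquares-≤1 (true  ∷ false ∷ []) _ = s≤s z≤n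
blockSquares-≤1 (false ∷ true  ∷ []) _ = s≤s z≤n
blockSquares-≤1 (false ∷ false ∷ []) _ = z≤n
blockSquares-≤1 (_ ∷ _ ∷ _ ∷ _)      (s≤s (s≤s ()))

blockSquares-two≤ : ∀ b₁ b₂ b₃ → 2 ≤ blockSquares (b₁ ∷ b₂ ∷ b₃ ∷ []) → b₂ ≡ not b₁ × b₃ ≡ b₁
blockSquares-two≤ true  false true  _ = refl , refl
blockSquares-two≤ false true  false _ = refl , refl
blockSquares-two≤ true  true  true  ()
blockSquares-two≤ true  true  false (s≤s ())
blockSquares-two≤ true  false false (s≤s ())
blockSquares-two≤ false true  true  (s≤s ())
blockSquares-two≤ false false true  (s≤s ())
blockSquares-two≤ false false false ()

blockSquares-alternating : ∀ b → blockSquares (b ∷ not b ∷ b ∷ []) ≡ 2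
blockSquares-alternating true  = refl
blockSquares-alternating false = refl

Ordered : ∀ {A : Set} → A → A → Bool → List A → Set
Ordered x y true  = Precedes x y
Ordered x y false = Precedes y x

record Zigzag {A : Set} (x y : A) (p₁ p₂ p₃ : List A) : Set where
  constructor zigzag
  field
    order₁ : Precedes x y p₁
    order₂ : Precedes y x p₂
    order₃ : Precedes x y p₃

open Zigzag

zigzag-trans : ∀ {A : Set} {x y z : A} {p₁ p₂ p₃} →
               Zigzag x y p₁ p₂ p₃ → Zigzag y z p₁ p₂ p₃ → Zigzag x z p₁ p₂ p₃
zigzag-trans (zigzag x<y₁ y<x₂ x<y₃) (zigzag y<z₁ z<y₂ y<z₃) =
  zigzag (precedes-trans x<y₁ y<z₁) (precedes-trans z<y₂ y<x₂) (precedes-trans x<y₃ y<z₃)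

module _ {n : ℕ} {x y : Fin n} (x≢y : x ≢ y) where

  ordered-unique : ∀ {b b′ p} → Ordered x y b p → Ordered x y b′ p → b ≡ b′
  ordered-unique {true}  {true}  _   _   = refl
  ordered-unique {true}  {false} x<y y<x = ⊥-elim (x≢y (precedes-antisym x<y y<x))
  ordered-unique {false} {true}  y<x x<y = ⊥-elim (x≢y (precedes-antisym x<y y<x))
  ordered-unique {false} {false} _   _   = refl

  orientation : ∀ {p} → IsPermutation p → ∃ λ b → Ordered x y b p
  orientation perm with precedes-total {y = y} (count≡1⇒∈ (perm x))
  ... | inj₁ x<y = true  , x<y
  ... | inj₂ y<x = false , y<x

  orientations : ∀ {ps} → All IsPermutation ps → ∃ λ bs → Pointwise (Ordered x y) bs ps
  orientations []             = [] , []
  orientations (perm ∷ perms) with orientation perm | orientations perms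
  ... | b , o | bs , os = b ∷ bs , o ∷ os

  ordered-restrict : ∀ {b p} → IsPermutation p → Ordered x y b p →
                     restrict x y p ≡ map (pairing x y) (block b)
  ordered-restrict {true}      perm x<y = restrict-precedes x≢y (perm x) (perm y) x<y
  ordered-restrict {false} {p} perm y<x =
    trans (restrict-comm x y p) (restrict-precedes (x≢y ∘ sym) (perm y) (perm x) y<x)

  restrict-concat : ∀ {bs ps} → All IsPermutation ps → Pointwise (Ordered x y) bs ps →
                    restrict x y (concat ps) ≡ map (pairing x y) (concatMap block bs)
  restrict-concat []             []       = refl
  restrict-concat {b ∷ bs} {p ∷ ps} (perm ∷ perms) (o ∷ os) = begin
    restrict x y (p ++ concat ps)
      ≡⟨ filter-++ _ p (concat ps) ⟩
    restrict x y p ++ restrict x y (concat ps)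
      ≡⟨ cong₂ _++_ (ordered-restrict perm o) (restrict-concat perms os) ⟩
    map (pairing x y) (block b) ++ map (pairing x y) (concatMap block bs)
      ≡⟨ map-++ (pairing x y) (block b) _ ⟨
    map (pairing x y) (concatMap block (b ∷ bs))
      ∎
    where open ≡-Reasoning

  squareCount-concat : ∀ {bs ps} → All IsPermutation ps → Pointwise (Ordered x y) bs ps →
                       squareCount x y (concat ps) ≡ blockSquares bs
  squareCount-concat {bs} {ps} perms os =
    squareCount-pairing x≢y {concat ps} (concatMap block bs) (restrict-concat perms os)

  squareCount-≤1 : ∀ {ps} → All IsPermutation ps → length ps ≤ 2 → squareCount x y (concat ps) ≤ 1
  squareCount-≤1 perms len≤2 with orientations perms
  ... | bs , os rewrite squareCount-concat perms os =
    blockSquares-≤1 bs (subst (_≤ 2) (sym (Pointwise-length os)) len≤2)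

  alternating⇒zigzag : ∀ {b p₁ p₂ p₃} →
                       Ordered x y b p₁ → Ordered x y (not b) p₂ → Ordered x y b p₃ →
                       Zigzag x y p₁ p₂ p₃ ⊎ Zigzag y x p₁ p₂ p₃
  alternating⇒zigzag {true}  o₁ o₂ o₃ = inj₁ (zigzag o₁ o₂ o₃)
  alternating⇒zigzag {false} o₁ o₂ o₃ = inj₂ (zigzag o₁ o₂ o₃)

  two≤squareCount⇔zigzag : ∀ {p₁ p₂ p₃} → All IsPermutation (p₁ ∷ p₂ ∷ p₃ ∷ []) →
                           2 ≤ squareCount x y (concat (p₁ ∷ p₂ ∷ p₃ ∷ [])) ⇔
                           (Zigzag x y p₁ p₂ p₃ ⊎ Zigzag y x p₁ p₂ p₃)
  two≤squareCount⇔zigzag {p₁} {p₂} {p₃} perms with orientations perms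
  ... | b₁ ∷ b₂ ∷ b₃ ∷ [] , os@(o₁ ∷ o₂ ∷ o₃ ∷ []) rewrite squareCount-concat perms os =
    mk⇔ to from
    where
    to : 2 ≤ blockSquares (b₁ ∷ b₂ ∷ b₃ ∷ []) → Zigzag x y p₁ p₂ p₃ ⊎ Zigzag y x p₁ p₂ p₃
    to two≤ with blockSquares-two≤ b₁ b₂ b₃ two≤
    ... | refl , refl = alternating⇒zigzag o₁ o₂ o₃

    alternating : ∀ b → Ordered x y b p₁ → Ordered x y (not b) p₂ → Ordered x y b p₃ →
                  2 ≤ blockSquares (b₁ ∷ b₂ ∷ b₃ ∷ [])
    alternating b z₁ z₂ z₃
      with refl ← ordered-unique o₁ z₁ | refl ← ordered-unique o₂ z₂ | refl ← ordered-unique o₃ z₃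
      = ≤-reflexive (sym (blockSquares-alternating b))

    from : Zigzag x y p₁ p₂ p₃ ⊎ Zigzag y x p₁ p₂ p₃ → 2 ≤ blockSquares (b₁ ∷ b₂ ∷ b₃ ∷ [])
    from (inj₁ (zigzag z₁ z₂ z₃)) = alternating true  z₁ z₂ z₃
    from (inj₂ (zigzag z₁ z₂ z₃)) = alternating false z₁ z₂ z₃

module _ {n : ℕ} {v : Fin n} where

  first-of-permutation : ∀ {q} → IsPermutation q → (∀ a → a ≢ v → Precedes v a q) →
                         ∃ λ t → q ≡ v ∷ t
  first-of-permutation {[]}    perm _ with () ← perm v
  first-of-permutation {c ∷ t} _    v<all with c ≟ v
  ... | yes refl = t , refl
  ... | no c≢v   = ⊥-elim (c≢v (sym (precedes-head (v<all c c≢v))))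

  last-of-permutation : ∀ {p} → IsPermutation p → (∀ a → a ≢ v → Precedes a v p) →
                        ∃ λ s → p ≡ s ∷ʳ v
  last-of-permutation {p} perm all<v with initLast p
  ... | []      with () ← perm v
  ... | s ∷ʳ′ c with c ≟ v
  ...   | yes refl = s , refl
  ...   | no c≢v   = ⊥-elim (c≢v (sym (∷ʳ-injectiveʳ (c ∷ []) (restrict c v s) restricted)))
    where
    restricted : c ∷ v ∷ [] ≡ restrict c v s ∷ʳ c
    restricted =
      trans (sym (restrict-precedes c≢v (perm c) (perm v) (all<v c c≢v))) (restrict-∷ʳ c v s)

  junction-square : ∀ {p q} → IsPermutation p → IsPermutation q →
                    (∀ a → a ≢ v → Precedes a v p) → (∀ a → a ≢ v → Precedes v a q) →
                    ∀ u r → ∃₂ λ s t → u ++ p ++ q ++ r ≡ s ++ v ∷ v ∷ t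
  junction-square p-perm q-perm all<v v<all u r
    with s , refl ← last-of-permutation p-perm all<v | t , refl ← first-of-permutation q-perm v<all
    = u ++ s , t ++ r , (begin
      u ++ (s ∷ʳ v) ++ v ∷ t ++ r  ≡⟨ cong (u ++_) (∷ʳ-++ s v (v ∷ t ++ r)) ⟩
      u ++ s ++ v ∷ v ∷ t ++ r     ≡⟨ ++-assoc u s _ ⟨
      (u ++ s) ++ v ∷ v ∷ t ++ r   ∎)
    where open ≡-Reasoning

  zigzags⇒square : ∀ {p₁ p₂ p₃} → All IsPermutation (p₁ ∷ p₂ ∷ p₃ ∷ []) →
                   (∀ a → a ≢ v → Zigzag a v p₁ p₂ p₃ ⊎ Zigzag v a p₁ p₂ p₃) →
                   (∀ a b → a ≢ v → b ≢ v → a ≢ b → ¬ Zigzag a b p₁ p₂ p₃) →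
                   ∃₂ λ s t → concat (p₁ ∷ p₂ ∷ p₃ ∷ []) ≡ s ++ v ∷ v ∷ t
  zigzags⇒square {[]} (perm₁ ∷ _) _ _ with () ← perm₁ v
  zigzags⇒square {h ∷ p₁} {p₂} {p₃} (perm₁ ∷ perm₂ ∷ perm₃ ∷ []) flips noFlips with h ≟ v
  ... | yes refl =
    junction-square perm₂ perm₃ (λ a → order₂ ∘ zigzag-from-v a) (λ a → order₃ ∘ zigzag-from-v a)
                    (h ∷ p₁) []
    where
    zigzag-from-v : ∀ a → a ≢ v → Zigzag v a (h ∷ p₁) p₂ p₃
    zigzag-from-v a a≢v with flips a a≢v
    ... | inj₁ a-to-v = ⊥-elim (a≢v (precedes-antisym (order₁ a-to-v) here))
    ... | inj₂ v-to-a = v-to-a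
  ... | no h≢v =
    junction-square perm₁ perm₂ (λ a → order₁ ∘ zigzag-to-v a) (λ a → order₂ ∘ zigzag-to-v a)
                    [] (p₃ ++ [])
    where
    head-to-v : Zigzag h v (h ∷ p₁) p₂ p₃
    head-to-v with flips h h≢v
    ... | inj₁ h-to-v = h-to-v
    ... | inj₂ v-to-h = ⊥-elim (h≢v (sym (precedes-head (order₁ v-to-h))))

    zigzag-to-v : ∀ a → a ≢ v → Zigzag a v (h ∷ p₁) p₂ p₃
    zigzag-to-v a a≢v with a ≟ h | flips a a≢v
    ... | yes refl | _           = head-to-v
    ... | no _     | inj₁ a-to-v = a-to-v
    ... | no a≢h   | inj₂ v-to-a =
      ⊥-elim (noFlips h a h≢v a≢v (a≢h ∘ sym) (zigzag-trans head-to-v v-to-a))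

module _ {n : ℕ} {E : Fin n → Fin n → Set} where

  concat≤2⇒complete : ∀ {j w} → IsConcatOfPerms j w → j ≤ 2 → Is1-11-Rep E w →
                      ∀ {x y} → x ≢ y → E x y
  concat≤2⇒complete (ps , refl , perms , refl) j≤2 (_ , rep) {x} {y} x≢y =
    Equivalence.from (rep x y x≢y) (squareCount-≤1 x≢y perms j≤2)

  module _ {p₁ p₂ p₃ : List (Fin n)} (perms : All IsPermutation (p₁ ∷ p₂ ∷ p₃ ∷ []))
           (rep : Is1-11-Rep E (concat (p₁ ∷ p₂ ∷ p₃ ∷ []))) {x y : Fin n} (x≢y : x ≢ y) where

    nonadjacent⇒zigzag : ¬ E x y → Zigzag x y p₁ p₂ p₃ ⊎ Zigzag y x p₁ p₂ p₃
    nonadjacent⇒zigzag ¬xy =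
      Equivalence.to (two≤squareCount⇔zigzag x≢y perms)
                     (≰⇒> (¬xy ∘ Equivalence.from (proj₂ rep x y x≢y)))

    adjacent⇒¬zigzag : E x y → ¬ Zigzag x y p₁ p₂ p₃
    adjacent⇒¬zigzag xy x-to-y =
      ≤⇒≯ (Equivalence.to (proj₂ rep x y x≢y) xy)
          (Equivalence.from (two≤squareCount⇔zigzag x≢y perms) (inj₁ x-to-y))

  isolated-clique⇒¬squareFree : ∀ {v} → (∀ a → a ≢ v → ¬ E a v) →
                                (∀ a b → a ≢ v → b ≢ v → a ≢ b → E a b) →
                                ∀ {w} → IsConcatOfPerms 3 w → Is1-11-Rep E w → ¬ SquareFree w
  isolated-clique⇒¬squareFree {v} isolated clique (_ ∷ _ ∷ _ ∷ [] , refl , perms , refl) rep squareFree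
    with s , t , w≡svvt ← zigzags⇒square perms
           (λ a a≢v → nonadjacent⇒zigzag perms rep a≢v (isolated a a≢v))
           (λ a b a≢v b≢v a≢b → adjacent⇒¬zigzag perms rep a≢b (clique a b a≢v b≢v a≢b))
    = squareFree (s , v ∷ [] , t , (λ ()) , w≡svvt)

triangle : ∀ a b → a ≢ 3F → b ≢ 3F → a ≢ b → K3+K1-Adj a b
triangle 0F 1F _   _   _   = e01
triangle 0F 2F _   _   _   = e02
triangle 1F 0F _   _   _   = e10
triangle 1F 2F _   _   _   = e12
triangle 2F 0F _   _   _   = e20
triangle 2F 1F _   _   _   = e21
triangle 3F _  a≢3 _   _   = ⊥-elim (a≢3 refl)
triangle _  3F _   b≢3 _   = ⊥-elim (b≢3 refl)
triangle 0F 0F _   _   a≢b = ⊥-elim (a≢b refl)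
triangle 1F 1F _   _   a≢b = ⊥-elim (a≢b refl)
triangle 2F 2F _   _   a≢b = ⊥-elim (a≢b refl)

edge⇔≤1 : ∀ {A : Set} {k} → A → True (k ≤? 1) → A ⇔ (k ≤ 1)
edge⇔≤1 a k≤1 = mk⇔ (λ _ → toWitness k≤1) (λ _ → a)

nonEdge⇔≤1 : ∀ {A : Set} {k} → ¬ A → False (k ≤? 1) → A ⇔ (k ≤ 1)
nonEdge⇔≤1 ¬a k≰1 = mk⇔ (⊥-elim ∘ ¬a) (⊥-elim ∘ toWitnessFalse k≰1)

v-last v-first : List (Fin 4)
v-last  = 0F ∷ 1F ∷ 2F ∷ 3F ∷ []
v-first = 3F ∷ 0F ∷ 1F ∷ 2F ∷ []

K3+K1-represented : HasPermRep K3+K1-Adj 3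
K3+K1-represented =
  concat ps , (ps , refl , v-last-perm ∷ v-first-perm ∷ v-last-perm ∷ [] , refl) , (λ ()) , adjacency
  where
  ps : List (List (Fin 4))
  ps = v-last ∷ v-first ∷ v-last ∷ []

  v-last-perm : IsPermutation v-last
  v-last-perm = λ { 0F → refl ; 1F → refl ; 2F → refl ; 3F → refl }

  v-first-perm : IsPermutation v-first
  v-first-perm = λ { 0F → refl ; 1F → refl ; 2F → refl ; 3F → refl }

  adjacency : ∀ x y → x ≢ y → K3+K1-Adj x y ⇔ (squareCount x y (concat ps) ≤ 1)
  adjacency 0F 1F _   = edge⇔≤1 e01 _
  adjacency 0F 2F _   = edge⇔≤1 e02 _
  adjacency 1F 0F _   = edge⇔≤1 e10 _
  adjacency 1F 2F _   = edge⇔≤1 e12 _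
  adjacency 2F 0F _   = edge⇔≤1 e20 _
  adjacency 2F 1F _   = edge⇔≤1 e21 _
  adjacency 0F 3F _   = nonEdge⇔≤1 (λ ()) _
  adjacency 1F 3F _   = nonEdge⇔≤1 (λ ()) _
  adjacency 2F 3F _   = nonEdge⇔≤1 (λ ()) _
  adjacency 3F 0F _   = nonEdge⇔≤1 (λ ()) _
  adjacency 3F 1F _   = nonEdge⇔≤1 (λ ()) _
  adjacency 3F 2F _   = nonEdge⇔≤1 (λ ()) _
  adjacency 0F 0F x≢y = ⊥-elim (x≢y refl)
  adjacency 1F 1F x≢y = ⊥-elim (x≢y refl)
  adjacency 2F 2F x≢y = ⊥-elim (x≢y refl)
  adjacency 3F 3F x≢y = ⊥-elim (x≢y refl)

K3+K1-needs-three : (j : ℕ) → j < 3 → ¬ HasPermRep K3+K1-Adj j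
K3+K1-needs-three j j<3 (_ , concatenation , rep)
  with () ← concat≤2⇒complete concatenation (≤-pred j<3) rep {0F} {3F} (λ ())

mainTheorem7 : Rπ≡ K3+K1-Adj 3 ×
    ((w : List (Fin 4)) → IsConcatOfPerms 3 w → Is1-11-Rep K3+K1-Adj w → ¬ SquareFree w)
mainTheorem7 =
  (K3+K1-represented , K3+K1-needs-three) ,
  λ _ → isolated-clique⇒¬squareFree (λ _ _ ()) triangle
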